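{- Let $X\subseteq B^n$ be well-behaved. Then for every $x\in X$ there is a prunable channel $i\in p(X)$ such that $x/i\in X/i$.
   Context: $B=\{0,1\}$, $[n]=\{1,\dots,n\}$. For $x\in B^n$, $x/i\in B^{n-1}$ is $x$ with entry $i$ deleted; $X/i=\{x/i\mid x\in X,\ x_i=1\}$. The one-hot sequence $e^{(i,n)}$ has a $1$ exactly at position $i$; $p(X)=\{i\in[n]\mid e^{(i,n)}\in X\}$. Threshold sets: for a permutation $y$ of $(1,\dots,n)$, $T(y)=\{([y_1\ge k],\dots,[y_n\ge k])\mid 1\le k\le n+1\}$, where $[P]=1$ if $P$ holds and $0$ otherwise. $X\subseteq B^n$ is well-behaved if it is a union of threshold sets. -}

module Defs where

open import Level using (0ℓ)
open import Data.Bool using (Bool; true; false)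
open import Data.Nat using (ℕ; suc; _≤_; _≤?_)
open import Data.Fin using (Fin; toℕ; _≟_)
open import Data.Fin.Permutation using (Permutation′; _⟨$⟩ʳ_)
open import Data.Vec using (Vec; tabulate; removeAt; lookup)
open import Data.Product using (Σ; ∃; _×_)
open import Relation.Nullary.Decidable using (⌊_⌋)
open import Relation.Binary.PropositionalEquality using (_≡_)
open import Relation.Unary using (Pred)
open import Function.Bundles using (_⇔_)

-- B^n as length-n boolean vectors; positions are Fin n (position i+1 on paper = Fin index i).
BSeq : ℕ → Set
BSeq n = Vec Bool n

BSet : ℕ → Set₁
BSet n = Pred (BSeq n) 0ℓ

-- A permutation y of (1,…,n): entry j is y_j = 1 + π(j) for a bijection π of Fin n.
yVal : ∀ {n} → Permutation′ n → Fin n → ℕ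
yVal π j = suc (toℕ (π ⟨$⟩ʳ j))

T : ∀ {n} → Permutation′ n → BSet n
T {n} π x = Σ ℕ λ k → (1 ≤ k) × (k ≤ suc n) × (x ≡ tabulate (λ j → ⌊ k ≤? yVal π j ⌋))

WellBehaved : ∀ {n} → BSet n → Set₁
WellBehaved {n} X =
  Σ Set λ I → Σ (I → Permutation′ n) λ ys → ∀ x → (X x ⇔ (Σ I λ a → T (ys a) x))

oneHot : ∀ {n} → Fin n → BSeq n
oneHot i = tabulate (λ j → ⌊ j ≟ i ⌋)

InP : ∀ {n} → BSet n → Fin n → Set
InP X i = X (oneHot i)

del : ∀ {m} → BSeq (suc m) → Fin (suc m) → BSeq m
del x i = removeAt x i

quot : ∀ {m} → BSet (suc m) → Fin (suc m) → BSet m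
quot X i z = Σ (BSeq _) λ x → X x × (lookup x i ≡ true) × (del x i ≡ z)

module Submission where

open import Defs
open import Data.Bool using (true; false)
open import Data.Nat using (ℕ; suc; _≤_; _<_; _≤?_; s≤s; z≤n)
open import Data.Nat.Properties using (≤-refl; ≤-trans; n≤1+n; ≤∧≢⇒<; ≰⇒>; <⇒≱; ≤⇒≯)
open import Data.Fin using (Fin; toℕ; fromℕ; _≟_; punchIn; punchOut)
open import Data.Fin.Properties using (toℕ-fromℕ; toℕ<n; toℕ≤pred[n]; toℕ-injective; punchInᵢ≢i; punchOut-punchIn)
open import Data.Fin.Permutation using (Permutation′; _⟨$⟩ʳ_; _⟨$⟩ˡ_; inverseʳ; inverseˡ)
open import Data.Vec using (Vec; tabulate; lookup; removeAt)
open import Data.Vec.Properties using (lookup∘tabulate; tabulate∘lookup; tabulate-cong; removeAt-punchOut)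
open import Data.Product using (Σ; _×_; _,_)
open import Function.Bundles using (Equivalence)
open import Relation.Nullary using (¬_; Dec; yes; no)
open import Relation.Nullary.Decidable using (dec-true; dec-false; isYes≗does; ⌊_⌋)
open import Relation.Binary.PropositionalEquality using (_≡_; _≢_; refl; sym; trans; cong; subst; module ≡-Reasoning)

-- Every x ∈ X is a threshold vector ([y_j ≥ k])_j of some y with T(y) ⊆ X.
-- For the channel i with y_i = n, threshold n is the one-hot e_i, so i ∈ p(X).
-- If k ≤ n then x_i = 1 and x itself witnesses x / i ∈ X / i; otherwise
-- k = n + 1, so x = 0 and e_i witnesses it.

⌊⌋-true : ∀ {A : Set} (a? : Dec A) → A → ⌊ a? ⌋ ≡ true
⌊⌋-true a? a = trans (isYes≗does a?) (dec-true a? a)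

⌊⌋-false : ∀ {A : Set} (a? : Dec A) → ¬ A → ⌊ a? ⌋ ≡ false
⌊⌋-false a? ¬a = trans (isYes≗does a?) (dec-false a? ¬a)

lookup-extensionality : ∀ {A : Set} {n} {u v : Vec A n} → (∀ j → lookup u j ≡ lookup v j) → u ≡ v
lookup-extensionality {u = u} {v} u≗v = begin
  u                   ≡⟨ sym (tabulate∘lookup u) ⟩
  tabulate (lookup u) ≡⟨ tabulate-cong u≗v ⟩
  tabulate (lookup v) ≡⟨ tabulate∘lookup v ⟩
  v                   ∎
  where open ≡-Reasoning

removeAt-cong : ∀ {A : Set} {n} (u v : Vec A (suc n)) (i : Fin (suc n)) →
  (∀ j → i ≢ j → lookup u j ≡ lookup v j) → removeAt u i ≡ removeAt v i
removeAt-cong u v i u≗v = lookup-extensionality removed≗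
  where
  open ≡-Reasoning
  removed≗ : ∀ j → lookup (removeAt u i) j ≡ lookup (removeAt v i) j
  removed≗ j = begin
    lookup (removeAt u i) j               ≡⟨ cong (lookup (removeAt u i)) (sym (punchOut-punchIn i)) ⟩
    lookup (removeAt u i) (punchOut i≢ij) ≡⟨ removeAt-punchOut u i≢ij ⟩
    lookup u (punchIn i j)                ≡⟨ u≗v (punchIn i j) i≢ij ⟩
    lookup v (punchIn i j)                ≡⟨ removeAt-punchOut v i≢ij ⟨
    lookup (removeAt v i) (punchOut i≢ij) ≡⟨ cong (lookup (removeAt v i)) (punchOut-punchIn i) ⟩
    lookup (removeAt v i) j               ∎
    where
    i≢ij : i ≢ punchIn i j
    i≢ij eq = punchInᵢ≢i i j (sym eq)

lookup-oneHot-self : ∀ {n} (i : Fin n) → lookup (oneHot i) i ≡ true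
lookup-oneHot-self i = trans (lookup∘tabulate _ i) (⌊⌋-true (i ≟ i) refl)

lookup-oneHot-≢ : ∀ {n} {i j : Fin n} → i ≢ j → lookup (oneHot i) j ≡ false
lookup-oneHot-≢ {i = i} {j} i≢j = trans (lookup∘tabulate _ j) (⌊⌋-false (j ≟ i) (λ j≡i → i≢j (sym j≡i)))

quot-of-oneHot : ∀ {m} {X : BSet (suc m)} {i : Fin (suc m)} → InP X i →
  (x : BSeq (suc m)) → (∀ j → i ≢ j → lookup x j ≡ false) → quot X i (del x i)
quot-of-oneHot {i = i} e∈X x x≡0 =
  oneHot i , e∈X , lookup-oneHot-self i ,
  removeAt-cong (oneHot i) x i (λ j i≢j → trans (lookup-oneHot-≢ i≢j) (sym (x≡0 j i≢j)))

threshold : ∀ {n} → Permutation′ n → ℕ → BSeq n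
threshold π k = tabulate (λ j → ⌊ k ≤? yVal π j ⌋)

lookup-threshold : ∀ {n} (π : Permutation′ n) k j → lookup (threshold π k) j ≡ ⌊ k ≤? yVal π j ⌋
lookup-threshold π k = lookup∘tabulate _

yVal≤n : ∀ {n} (π : Permutation′ n) j → yVal π j ≤ n
yVal≤n π j = toℕ<n (π ⟨$⟩ʳ j)

top : ∀ {m} → Permutation′ (suc m) → Fin (suc m)
top {m} π = π ⟨$⟩ˡ fromℕ m

yVal-top : ∀ {m} (π : Permutation′ (suc m)) → yVal π (top π) ≡ suc m
yVal-top {m} π = cong suc (trans (cong toℕ (inverseʳ π)) (toℕ-fromℕ m))

yVal-off-top≤m : ∀ {m} (π : Permutation′ (suc m)) {j} → top π ≢ j → yVal π j ≤ m
yVal-off-top≤m {m} π {j} top≢j = ≤∧≢⇒< (toℕ≤pred[n] (π ⟨$⟩ʳ j)) πj≢m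
  where
  πj≢m : toℕ (π ⟨$⟩ʳ j) ≢ m
  πj≢m eq = top≢j (begin
    π ⟨$⟩ˡ fromℕ m     ≡⟨ cong (π ⟨$⟩ˡ_) (toℕ-injective (trans (toℕ-fromℕ m) (sym eq))) ⟩
    π ⟨$⟩ˡ (π ⟨$⟩ʳ j) ≡⟨ inverseˡ π ⟩
    j                 ∎)
    where open ≡-Reasoning

lookup-threshold-top : ∀ {m} (π : Permutation′ (suc m)) {k} → k ≤ suc m →
  lookup (threshold π k) (top π) ≡ true
lookup-threshold-top π {k} k≤ =
  trans (lookup-threshold π k (top π)) (⌊⌋-true (k ≤? _) (subst (k ≤_) (sym (yVal-top π)) k≤))

threshold-beyond : ∀ {n} (π : Permutation′ n) {k} → n < k → ∀ j → lookup (threshold π k) j ≡ false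
threshold-beyond π {k} n<k j =
  trans (lookup-threshold π k j) (⌊⌋-false (k ≤? _) (<⇒≱ (≤-trans (s≤s (yVal≤n π j)) n<k)))

threshold-top≡oneHot : ∀ {m} (π : Permutation′ (suc m)) → threshold π (suc m) ≡ oneHot (top π)
threshold-top≡oneHot {m} π = lookup-extensionality same
  where
  same : ∀ j → lookup (threshold π (suc m)) j ≡ lookup (oneHot (top π)) j
  same j with top π ≟ j
  ... | yes refl = trans (lookup-threshold-top π ≤-refl) (sym (lookup-oneHot-self (top π)))
  ... | no top≢j = trans (lookup-threshold π (suc m) j)
                     (trans (⌊⌋-false (suc m ≤? _) (≤⇒≯ (yVal-off-top≤m π top≢j))) (sym (lookup-oneHot-≢ top≢j)))

mainTheorem14 : ∀ {m : ℕ} (X : BSet (suc m)) → WellBehaved X →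
    ∀ (x : BSeq (suc m)) → X x →
      Σ (Fin (suc m)) λ i → InP X i × quot X i (del x i)
mainTheorem14 {m} X (_ , ys , X⇔T) x x∈X with Equivalence.to (X⇔T x) x∈X
... | a , k , _ , _ , refl = top π , e∈X , x/i∈X/i
  where
  π : Permutation′ (suc m)
  π = ys a
  e∈X : InP X (top π)
  e∈X = subst X (threshold-top≡oneHot π) (Equivalence.from (X⇔T _) (a , suc m , s≤s z≤n , n≤1+n _ , refl))
  x/i∈X/i : quot X (top π) (del x (top π))
  x/i∈X/i with k ≤? suc m
  ... | yes k≤m+1 = x , x∈X , lookup-threshold-top π k≤m+1 , refl
  ... | no k≰m+1 = quot-of-oneHot e∈X x (λ j _ → threshold-beyond π (≰⇒> k≰m+1) j)
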